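{- Let $G=(V,E)$ be a graph with a partition $\Gamma=\{E_1,\ldots,E_\gamma\}$ of $E$ into nonempty groups. If for some $i$ the edge set $E_i$ is (the edge set of) a 3-cycle or an edge-disjoint union of 3-cycles, then, with edge utilities, $\mathrm{DF\text{ - }MP}(G,\Gamma)\le 2/3$.
   Context: Max-Cut with edge utilities: a cut is a subset $S\subseteq V$; for an edge $e$, $X_e(S)=1$ if $e$ has exactly one endpoint in $S$ and $0$ otherwise, and $f_S(F)=\sum_{e\in F}X_e(S)$ for $F\subseteq E$. $\mathrm{DF\text{ - }MP}(G,\Gamma)=\max_{D}\min_{i\in[\gamma]}\mathbb{E}_{S\sim D}f_S(E_i)/|E_i|$, where the maximum is over all probability distributions $D$ on the subsets of $V$.
   Formalization: The probability distributions D on the subsets of V take only rational probabilities. -}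

module Defs where

open import Data.Nat as ℕ using (ℕ; zero; suc)
open import Data.Integer using (+_)
open import Data.Rational using (ℚ; 0ℚ; 1ℚ; _+_; _*_; _≤_; _/_)
open import Data.Fin using (Fin; zero; suc; _≟_)
open import Data.Fin.Subset using (Subset)
open import Data.Bool using (Bool; true; false; if_then_else_; _xor_)
open import Data.Vec using (lookup)
open import Data.List using (List; map; sum; foldr)
open import Data.List.Relation.Unary.All using (All)
open import Data.Product using (_×_; _,_; proj₁; proj₂; Σ; ∃; ∃-syntax)
open import Data.Sum using (_⊎_)
open import Relation.Nullary using (¬_; does)
open import Relation.Binary.PropositionalEquality using (_≡_)

Σℕ : (m : ℕ) → (Fin m → ℕ) → ℕ
Σℕ zero    f = 0
Σℕ (suc m) f = f zero ℕ.+ Σℕ m (λ k → f (suc k))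

SamePair : {n : ℕ} → Fin n × Fin n → Fin n × Fin n → Set
SamePair (u , v) (u' , v') = (u ≡ u' × v ≡ v') ⊎ (u ≡ v' × v ≡ u')

record Graph : Set where
  field
    n        : ℕ
    m        : ℕ
    edge     : Fin m → Fin n × Fin n
    loopless : ∀ e → ¬ (proj₁ (edge e) ≡ proj₂ (edge e))
    simple   : ∀ e e' → SamePair (edge e) (edge e') → e ≡ e'

-- A partition Γ = {E_1,…,E_γ} of E into nonempty groups:
-- edge e belongs to group (grp e); every group is nonempty.
record Partition (G : Graph) : Set where
  open Graph G
  field
    γ        : ℕ
    grp      : Fin m → Fin γ
    nonempty : ∀ (i : Fin γ) → ∃[ e ] grp e ≡ i

X : (G : Graph) → Fin (Graph.m G) → Subset (Graph.n G) → ℕ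
X G e S = if lookup S (proj₁ (Graph.edge G e)) xor lookup S (proj₂ (Graph.edge G e)) then 1 else 0

inGroup : {G : Graph} (Γ : Partition G) → Fin (Partition.γ Γ) → Fin (Graph.m G) → Bool
inGroup Γ i e = does (Partition.grp Γ e ≟ i)

groupSize : {G : Graph} (Γ : Partition G) → Fin (Partition.γ Γ) → ℕ
groupSize {G} Γ i = Σℕ (Graph.m G) (λ e → if inGroup Γ i e then 1 else 0)

f : {G : Graph} (Γ : Partition G) → Subset (Graph.n G) → Fin (Partition.γ Γ) → ℕ
f {G} Γ S i = Σℕ (Graph.m G) (λ e → if inGroup Γ i e then X G e S else 0)

-- a / b as a rational (b = 0 never occurs for nonempty groups; set to 0 then).
frac : ℕ → ℕ → ℚ
frac a zero    = 0ℚ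
frac a (suc b) = (+ a) / suc b

-- A probability distribution on subsets of V, given by a finite list of
-- (subset, probability) pairs with nonnegative probabilities summing to 1.
-- (Every distribution on the finite set of subsets has this form.)
record Distribution (n : ℕ) : Set where
  field
    support : List (Subset n × ℚ)
    nonneg  : All (λ sp → 0ℚ ≤ proj₂ sp) support
    total   : foldr (λ sp acc → proj₂ sp + acc) 0ℚ support ≡ 1ℚ

expectedFraction : {G : Graph} (Γ : Partition G) → Distribution (Graph.n G)
                 → Fin (Partition.γ Γ) → ℚ
expectedFraction Γ D i =
  foldr (λ sp acc → proj₂ sp * frac (f Γ (proj₁ sp) i) (groupSize Γ i) + acc) 0ℚ
        (Distribution.support D)

-- DF-MP(G,Γ) ≤ q, i.e. max_D min_i E_{S∼D} f_S(E_i)/|E_i| ≤ q: for every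
-- distribution D, some group i has expected fraction ≤ q.
DF-MP≤ : (G : Graph) (Γ : Partition G) → ℚ → Set
DF-MP≤ G Γ q = ∀ (D : Distribution (Graph.n G)) → ∃[ i ] expectedFraction Γ D i ≤ q

record Triangle (n : ℕ) : Set where
  field
    a b c : Fin n
    a≢b : ¬ a ≡ b
    b≢c : ¬ b ≡ c
    a≢c : ¬ a ≡ c

side : {n : ℕ} → Triangle n → Fin 3 → Fin n × Fin n
side t zero             = Triangle.a t , Triangle.b t
side t (suc zero)       = Triangle.b t , Triangle.c t
side t (suc (suc zero)) = Triangle.c t , Triangle.a t

-- E_i is (the edge set of) a 3-cycle or an edge-disjoint union of 3-cycles:
-- there are t ≥ 1 triangles whose sides are pairwise distinct edges and whose
-- union of sides is exactly E_i.
IsUnionOfTriangles : {G : Graph} (Γ : Partition G) → Fin (Partition.γ Γ) → Set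
IsUnionOfTriangles {G} Γ i =
  Σ ℕ λ t → Σ (Fin (suc t) → Triangle (Graph.n G)) λ tri →
    (∀ j k j' k' → SamePair (side (tri j) k) (side (tri j') k') → (j ≡ j' × k ≡ k'))
    × (∀ e → Partition.grp Γ e ≡ i → ∃[ j ] ∃[ k ] SamePair (Graph.edge G e) (side (tri j) k))
    × (∀ j k → ∃[ e ] (Partition.grp Γ e ≡ i × SamePair (Graph.edge G e) (side (tri j) k)))

{-# OPTIONS --safe #-}
module Submission where

-- Whatever the cut S, at most two sides of a triangle are cut, and E_i is the
-- disjoint union of the sides of its triangles, so 3 f_S(E_i) ≤ 2 |E_i|.  Averaging
-- this pointwise bound over any distribution D bounds the expected fraction of
-- group i by 2/3.

open import Defs
open import Data.Integer using (+_)
open import Data.Rational using (_/_)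
open import Data.Product using (∃-syntax)

open import Data.Nat as ℕ using (ℕ; zero; suc; z≤n; s≤s; NonZero)
import Data.Nat.Properties as ℕ
open import Algebra.Properties.CommutativeMonoid.Sum ℕ.+-0-commutativeMonoid
open import Algebra.Properties.Semiring.Sum ℕ.+-*-semiring using (*-distribˡ-sum)
import Data.Integer as ℤ
import Data.Integer.Properties as ℤ
open import Data.Rational as ℚ using (ℚ; 0ℚ)
import Data.Rational.Properties as ℚ
import Data.Rational.Unnormalised as ℚᵘ
import Data.Rational.Unnormalised.Properties as ℚᵘ
open import Data.Fin using (Fin; zero; suc; _≟_; punchIn)
open import Data.Fin.Properties using (punchInᵢ≢i)
open import Data.Fin.Subset using (Subset)
open import Data.Bool using (true; false; if_then_else_; _xor_)
open import Data.Bool.Properties using (xor-comm)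
open import Data.Vec using (lookup)
open import Data.List using (List; []; _∷_; foldr)
open import Data.List.Relation.Unary.All using (All; []; _∷_)
open import Data.Product using (_×_; _,_; proj₁; proj₂; ∃₂)
open import Data.Sum using (inj₁; inj₂)
open import Function using (_∘_)
open import Relation.Nullary using (¬_; does; yes; no)
open import Relation.Nullary.Decidable using (dec-true; dec-false)
open import Relation.Unary using (Pred; Decidable)
open import Relation.Binary.PropositionalEquality

Σℕ≡sum : ∀ m (g : Fin m → ℕ) → Σℕ m g ≡ sum g
Σℕ≡sum zero    g = refl
Σℕ≡sum (suc m) g = cong (g zero ℕ.+_) (Σℕ≡sum m (g ∘ suc))

sum-zero : ∀ {m} {g : Fin m → ℕ} → (∀ x → g x ≡ 0) → sum g ≡ 0
sum-zero {m} g≗0 = trans (sum-cong-≗ g≗0) (sum-replicate-zero m)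

sum-single : ∀ {m} (g : Fin m → ℕ) (x : Fin m) → (∀ y → y ≢ x → g y ≡ 0) → sum g ≡ g x
sum-single {suc m} g x vanishes = begin
  sum g                        ≡⟨ sum-remove g ⟩
  g x ℕ.+ sum (g ∘ punchIn x)  ≡⟨ cong (g x ℕ.+_) (sum-zero (λ y → vanishes _ (punchInᵢ≢i x y))) ⟩
  g x ℕ.+ 0                    ≡⟨ ℕ.+-identityʳ (g x) ⟩
  g x                          ∎
  where open ≡-Reasoning

sum-mono-≤ : ∀ {m} {g h : Fin m → ℕ} → (∀ x → g x ℕ.≤ h x) → sum g ℕ.≤ sum h
sum-mono-≤ {zero}  g≤h = z≤n
sum-mono-≤ {suc m} g≤h = ℕ.+-mono-≤ (g≤h zero) (sum-mono-≤ (g≤h ∘ suc))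

*-sum-mono-≤ : ∀ {m} p q {g h : Fin m → ℕ} → (∀ x → p ℕ.* g x ℕ.≤ q ℕ.* h x) →
               p ℕ.* sum g ℕ.≤ q ℕ.* sum h
*-sum-mono-≤ p q {g} {h} pg≤qh = subst₂ ℕ._≤_
  (sym (*-distribˡ-sum p g)) (sym (*-distribˡ-sum q h)) (sum-mono-≤ pg≤qh)

if-≟-refl : ∀ {m} (x : Fin m) (n : ℕ) → (if does (x ≟ x) then n else 0) ≡ n
if-≟-refl x n = cong (if_then n else 0) (dec-true (x ≟ x) refl)

if-≟-≢ : ∀ {m} (x y : Fin m) (n : ℕ) → x ≢ y → (if does (x ≟ y) then n else 0) ≡ 0
if-≟-≢ x y n x≢y = cong (if_then n else 0) (dec-false (x ≟ y) x≢y)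

sum-single₂ : ∀ {a b} (F : Fin a → Fin b → ℕ) (j₀ : Fin a) (k₀ : Fin b) →
              (∀ j k → ¬ (j ≡ j₀ × k ≡ k₀) → F j k ≡ 0) →
              ∑[ j < a ] ∑[ k < b ] F j k ≡ F j₀ k₀
sum-single₂ F j₀ k₀ vanishes =
  trans (sum-single _ j₀ (λ j j≢j₀ → sum-zero (λ k → vanishes j k (j≢j₀ ∘ proj₁))))
        (sum-single _ k₀ (λ k k≢k₀ → vanishes j₀ k (k≢k₀ ∘ proj₂)))

module _ {m a b ℓ} {P : Pred (Fin m) ℓ} (P? : Decidable P) (E : Fin a → Fin b → Fin m)
         (E-injective : ∀ {j k j′ k′} → E j k ≡ E j′ k′ → j ≡ j′ × k ≡ k′)
         (E-⊆ : ∀ j k → P (E j k))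
         (E-⊇ : ∀ {x} → P x → ∃₂ λ j k → x ≡ E j k)
         where

  private
    [_≡E_,_] : Fin m → Fin a → Fin b → ℕ → ℕ
    [ x ≡E j , k ] n = if does (x ≟ E j k) then n else 0

    count-preimages : ∀ (h : Fin m → ℕ) x →
      (if does (P? x) then h x else 0) ≡ ∑[ j < a ] ∑[ k < b ] [ x ≡E j , k ] (h x)
    count-preimages h x with P? x
    ... | no ¬Px = sym (sum-zero λ j → sum-zero λ k →
                     if-≟-≢ x (E j k) (h x) (λ { refl → ¬Px (E-⊆ j k) }))
    ... | yes Px with E-⊇ Px
    ... | j₀ , k₀ , refl = sym (trans
      (sum-single₂ _ j₀ k₀ (λ j k ≢ → if-≟-≢ (E j₀ k₀) (E j k) (h (E j₀ k₀)) (≢ ∘ E-injective ∘ sym)))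
      (if-≟-refl (E j₀ k₀) (h (E j₀ k₀))))

  sum-over-image : ∀ (h : Fin m → ℕ) →
    ∑[ x < m ] (if does (P? x) then h x else 0) ≡ ∑[ j < a ] ∑[ k < b ] h (E j k)
  sum-over-image h = begin
    ∑[ x < m ] (if does (P? x) then h x else 0)
      ≡⟨ sum-cong-≗ (count-preimages h) ⟩
    ∑[ x < m ] ∑[ j < a ] ∑[ k < b ] [ x ≡E j , k ] (h x)
      ≡⟨ ∑-comm (λ x j → ∑[ k < b ] [ x ≡E j , k ] (h x)) ⟩
    ∑[ j < a ] ∑[ x < m ] ∑[ k < b ] [ x ≡E j , k ] (h x)
      ≡⟨ sum-cong-≗ (λ j → ∑-comm λ x k → [ x ≡E j , k ] (h x)) ⟩
    ∑[ j < a ] ∑[ k < b ] ∑[ x < m ] [ x ≡E j , k ] (h x)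
      ≡⟨ sum-cong-≗ (λ j → sum-cong-≗ λ k → sum-single _ (E j k) (λ x → if-≟-≢ x (E j k) (h x))) ⟩
    ∑[ j < a ] ∑[ k < b ] [ E j k ≡E j , k ] (h (E j k))
      ≡⟨ sum-cong-≗ (λ j → sum-cong-≗ λ k → if-≟-refl (E j k) (h (E j k))) ⟩
    ∑[ j < a ] ∑[ k < b ] h (E j k)
      ∎
    where open ≡-Reasoning

SamePair-sym : ∀ {n} {p q : Fin n × Fin n} → SamePair p q → SamePair q p
SamePair-sym (inj₁ (refl , refl)) = inj₁ (refl , refl)
SamePair-sym (inj₂ (refl , refl)) = inj₂ (refl , refl)

SamePair-trans : ∀ {n} {p q r : Fin n × Fin n} → SamePair p q → SamePair q r → SamePair p r
SamePair-trans {p = _ , _} (inj₁ (refl , refl)) q~r                  = q~r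
SamePair-trans {p = _ , _} (inj₂ (refl , refl)) (inj₁ (refl , refl)) = inj₂ (refl , refl)
SamePair-trans {p = _ , _} (inj₂ (refl , refl)) (inj₂ (refl , refl)) = inj₁ (refl , refl)

cut : ∀ {n} → Subset n → Fin n × Fin n → ℕ
cut S (u , v) = if lookup S u xor lookup S v then 1 else 0

cut-SamePair : ∀ {n} (S : Subset n) {p q : Fin n × Fin n} → SamePair p q → cut S p ≡ cut S q
cut-SamePair S         (inj₁ (refl , refl)) = refl
cut-SamePair S {u , v} (inj₂ (refl , refl)) =
  cong (if_then 1 else 0) (xor-comm (lookup S u) (lookup S v))

triangle-cut≤2 : ∀ {n} (S : Subset n) (T : Triangle n) → ∑[ k < 3 ] cut S (side T k) ℕ.≤ 2
triangle-cut≤2 S T with lookup S (Triangle.a T) | lookup S (Triangle.b T) | lookup S (Triangle.c T)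
... | false | false | false = z≤n
... | false | false | true  = s≤s (s≤s z≤n)
... | false | true  | false = s≤s (s≤s z≤n)
... | false | true  | true  = s≤s (s≤s z≤n)
... | true  | false | false = s≤s (s≤s z≤n)
... | true  | false | true  = s≤s (s≤s z≤n)
... | true  | true  | false = s≤s (s≤s z≤n)
... | true  | true  | true  = z≤n

module UnionOfTriangles {G : Graph} (Γ : Partition G) (i : Fin (Partition.γ Γ)) (t : ℕ)
  (triangle : Fin (suc t) → Triangle (Graph.n G))
  (sides-distinct : ∀ j k j′ k′ → SamePair (side (triangle j) k) (side (triangle j′) k′) → j ≡ j′ × k ≡ k′)
  (group⊆sides : ∀ e → Partition.grp Γ e ≡ i → ∃[ j ] ∃[ k ] SamePair (Graph.edge G e) (side (triangle j) k))
  (sides⊆group : ∀ j k → ∃[ e ] (Partition.grp Γ e ≡ i × SamePair (Graph.edge G e) (side (triangle j) k)))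
  where
  open Graph G
  open Partition Γ

  sideEdge : Fin (suc t) → Fin 3 → Fin m
  sideEdge j k = proj₁ (sides⊆group j k)

  sideEdge-∈ : ∀ j k → grp (sideEdge j k) ≡ i
  sideEdge-∈ j k = proj₁ (proj₂ (sides⊆group j k))

  sideEdge-SamePair : ∀ j k → SamePair (edge (sideEdge j k)) (side (triangle j) k)
  sideEdge-SamePair j k = proj₂ (proj₂ (sides⊆group j k))

  sideEdge-injective : ∀ {j k j′ k′} → sideEdge j k ≡ sideEdge j′ k′ → j ≡ j′ × k ≡ k′
  sideEdge-injective {j} {k} {j′} {k′} eq = sides-distinct j k j′ k′ (SamePair-trans
    (SamePair-sym (sideEdge-SamePair j k))
    (subst (λ e → SamePair (edge e) (side (triangle j′) k′)) (sym eq) (sideEdge-SamePair j′ k′)))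

  sideEdge-surjective : ∀ {e} → grp e ≡ i → ∃₂ λ j k → e ≡ sideEdge j k
  sideEdge-surjective {e} e∈Eᵢ with group⊆sides e e∈Eᵢ
  ... | j , k , e~side = j , k , simple e (sideEdge j k)
                                   (SamePair-trans e~side (SamePair-sym (sideEdge-SamePair j k)))

  sum-group : (h : Fin m → ℕ) →
              Σℕ m (λ e → if inGroup Γ i e then h e else 0) ≡ ∑[ j < suc t ] ∑[ k < 3 ] h (sideEdge j k)
  sum-group h = trans (Σℕ≡sum m _)
    (sum-over-image (λ e → grp e ≟ i) sideEdge sideEdge-injective sideEdge-∈ sideEdge-surjective h)

  3*f≤2*groupSize : ∀ S → 3 ℕ.* f Γ S i ℕ.≤ 2 ℕ.* groupSize Γ i
  3*f≤2*groupSize S = begin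
    3 ℕ.* f Γ S i                  ≡⟨ cong (3 ℕ.*_) (sum-group (λ e → X G e S)) ⟩
    3 ℕ.* (∑[ j < suc t ] cutⱼ j)  ≤⟨ *-sum-mono-≤ 3 2 {cutⱼ} {λ _ → 3} triangle-bound ⟩
    2 ℕ.* (∑[ j < suc t ] 3)       ≡⟨ cong (2 ℕ.*_) (sum-group (λ _ → 1)) ⟨
    2 ℕ.* groupSize Γ i            ∎
    where
    open ℕ.≤-Reasoning
    cutⱼ : Fin (suc t) → ℕ
    cutⱼ j = ∑[ k < 3 ] X G (sideEdge j k) S
    triangle-bound : ∀ j → 3 ℕ.* cutⱼ j ℕ.≤ 2 ℕ.* 3
    triangle-bound j = ℕ.*-monoʳ-≤ 3 (subst (ℕ._≤ 2)
      (sum-cong-≗ λ k → sym (cut-SamePair S (sideEdge-SamePair j k)))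
      (triangle-cut≤2 S (triangle j)))

frac-≤ : ∀ a b p q .{{_ : NonZero q}} → q ℕ.* a ℕ.≤ p ℕ.* b → frac a b ℚ.≤ + p / q
frac-≤ a zero    p q           _      = ℚ.nonNegative⁻¹ (+ p / q) {{ℚ.normalize-nonNeg p q}}
frac-≤ a (suc b) p q@(suc q-1) qa≤pb = ℚ.toℚᵘ-cancel-≤
  (ℚᵘ.≤-respˡ-≃ (ℚᵘ.≃-sym (ℚ.toℚᵘ-fromℚᵘ (ℚᵘ.mkℚᵘ (+ a) b)))
  (ℚᵘ.≤-respʳ-≃ (ℚᵘ.≃-sym (ℚ.toℚᵘ-fromℚᵘ (ℚᵘ.mkℚᵘ (+ p) q-1)))
  (ℚᵘ.*≤* (subst₂ ℤ._≤_ (ℤ.pos-* a q) (ℤ.pos-* p (suc b))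
    (ℤ.+≤+ (subst (ℕ._≤ p ℕ.* suc b) (ℕ.*-comm q a) qa≤pb))))))

weightedSum-≤ : ∀ {A : Set} (x : A → ℚ) {q} → (∀ a → x a ℚ.≤ q) →
                (L : List (A × ℚ)) → All (λ aw → 0ℚ ℚ.≤ proj₂ aw) L →
                foldr (λ aw acc → proj₂ aw ℚ.* x (proj₁ aw) ℚ.+ acc) 0ℚ L
                  ℚ.≤ q ℚ.* foldr (λ aw acc → proj₂ aw ℚ.+ acc) 0ℚ L
weightedSum-≤ x {q} x≤q []            []          = ℚ.≤-reflexive (sym (ℚ.*-zeroʳ q))
weightedSum-≤ x {q} x≤q ((a , w) ∷ L) (0≤w ∷ 0≤L) = begin
  w ℚ.* x a ℚ.+ _      ≤⟨ ℚ.+-mono-≤ (ℚ.*-monoˡ-≤-nonNeg w {{ℚ.nonNegative 0≤w}} (x≤q a))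
                                      (weightedSum-≤ x x≤q L 0≤L) ⟩
  w ℚ.* q ℚ.+ q ℚ.* W  ≡⟨ cong (ℚ._+ q ℚ.* W) (ℚ.*-comm w q) ⟩
  q ℚ.* w ℚ.+ q ℚ.* W  ≡⟨ ℚ.*-distribˡ-+ q w W ⟨
  q ℚ.* (w ℚ.+ W)      ∎
  where
  open ℚ.≤-Reasoning
  W : ℚ
  W = foldr (λ aw acc → proj₂ aw ℚ.+ acc) 0ℚ L

expectedFraction-≤ : ∀ {G} (Γ : Partition G) D i {q} →
                     (∀ S → frac (f Γ S i) (groupSize Γ i) ℚ.≤ q) → expectedFraction Γ D i ℚ.≤ q
expectedFraction-≤ Γ D i {q} fraction≤q = begin
  expectedFraction Γ D i ≤⟨ weightedSum-≤ _ fraction≤q (Distribution.support D) (Distribution.nonneg D) ⟩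
  q ℚ.* _                ≡⟨ cong (q ℚ.*_) (Distribution.total D) ⟩
  q ℚ.* ℚ.1ℚ             ≡⟨ ℚ.*-identityʳ q ⟩
  q                      ∎
  where open ℚ.≤-Reasoning

corollary4p8 : (G : Graph) (Γ : Partition G)
               → ∃[ i ] IsUnionOfTriangles Γ i
               → DF-MP≤ G Γ ((+ 2) / 3)
corollary4p8 G Γ (i , t , triangle , distinct , group⊆sides , sides⊆group) D =
  i , expectedFraction-≤ Γ D i λ S → frac-≤ (f Γ S i) (groupSize Γ i) 2 3
        (UnionOfTriangles.3*f≤2*groupSize Γ i t triangle distinct group⊆sides sides⊆group S)
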